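{- For integers $q \ge 2$ and $r \ge 3$ there is a positive constant $c^{q\text{ - }\mathrm{ff}}_r$ (independent of $n$) such that for all $n \ge 1$, \[ c^{q\text{ - }\mathrm{ff}}_r \Big(\frac{q}{((q-1)(r-1)+1)^{\frac{1}{r-1}}}\Big)^n \le g^{q\text{ - }\mathrm{ff}}_r(n) \le (r-1)\, q^{\lceil \frac{(r-2)n}{r-1} \rceil}. \]
   Context: Let $[q]=\{1,\dots,q\}$. A family $x^{(0)}, x^{(1)},\ldots, x^{(r-1)}$ of $r$ distinct vectors in $[q]^n$ is a ($q$-ary) focal family with focus $x^{(0)}$ if for every coordinate $i \in [n]$, at least $r-2$ of the $r-1$ entries $x^{(1)}_i,\ldots,x^{(r-1)}_i$ are equal to $x^{(0)}_i$. A family $\mathcal{F}\subseteq[q]^n$ contains a focal family of size $r$ if some $r$ distinct members of $\mathcal{F}$, with some choice of focus among them, form a focal family. $g^{q\text{ - }\mathrm{ff}}_r(n)$ denotes the maximum of $|\mathcal{F}|$ over all $\mathcal{F} \subseteq [q]^n$ containing no focal family of size $r$. -}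

module Defs where

open import Data.Nat using (ℕ; zero; suc; _+_; _*_; _∸_; _≤_)
open import Data.Nat.DivMod using (_/_)
open import Data.Fin using (Fin)
import Data.Fin.Properties as FinP
open import Data.Vec using (Vec; lookup)
open import Data.List using (List; _∷_; length; filter)
open import Data.List.Membership.Propositional using (_∈_)
open import Data.List.Relation.Unary.All using (All)
open import Data.List.Relation.Unary.Unique.Propositional using (Unique)
open import Data.Product using (Σ; _×_)
open import Relation.Binary.PropositionalEquality using (_≡_)

Word : ℕ → ℕ → Set
Word q n = Vec (Fin q) n

-- A family in [q]^n: a list of words; (distinctness imposed separately by Unique).
Family : ℕ → ℕ → Set
Family q n = List (Word q n)

agreeCount : ∀ {q n} → Fin n → Word q n → List (Word q n) → ℕ
agreeCount i x0 ys = length (filter (λ y → lookup y i FinP.≟ lookup x0 i) ys)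

IsFocal : ∀ {q n} → ℕ → Word q n → List (Word q n) → Set
IsFocal {q} {n} r x0 ys =
  Unique (x0 ∷ ys) × length ys ≡ r ∸ 1 × ((i : Fin n) → r ∸ 2 ≤ agreeCount i x0 ys)

ContainsFocal : ∀ {q n} → ℕ → Family q n → Set
ContainsFocal {q} {n} r F =
  Σ (Word q n) λ x0 → Σ (List (Word q n)) λ ys →
    x0 ∈ F × All (_∈ F) ys × IsFocal r x0 ys

-- ceiling division: ⌈ a / b ⌉ for b ≥ 1 (value 0 for b = 0, never used)
ceilDiv : ℕ → ℕ → ℕ
ceilDiv a zero = 0
ceilDiv a (suc b) = (a + b) / suc b

-- Cut the coordinates into r − 1 blocks of ⌊n/(r − 1)⌋ consecutive positions. If a
-- member x of F had, for every block j, a twin y_j ∈ F differing from x only inside block j, then x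
-- and the y_j would form a focal family with focus x: at each coordinate only the twin of the block
-- containing it can disagree with x. So every x ∈ F is determined within F by its entries outside
-- some block, and |F| ≤ (r − 1) q^(n − ⌊n/(r − 1)⌋).
--
-- Lower bound: the alteration method. Colour the words of [q]^n with M colours uniformly at random,
-- keep the words of colour 0, and delete the focus of every focal family that was kept entirely.
-- Read coordinatewise, a focal family is a focus value followed by r − 1 entries of which at most
-- one differs from it, so there are at most (q((q − 1)(r − 1) + 1))^n of them, and each is kept
-- with probability M^(−r). Taking M^(r−1) ≈ 2((q − 1)(r − 1) + 1)^n, at most half of the q^n/M
-- expected kept words are deleted. The expectations are computed exactly by summing over all
-- colourings.

module Submission where

open import Defs
open import Data.Bool using (Bool; true; false; _∧_; _∨_; not; T; if_then_else_)
open import Data.Bool.ListAction using (all)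
open import Data.Bool.Properties using (∧-assoc; ∧-comm; ∨-zeroʳ; ∧-identityʳ)
open import Data.Fin using (Fin; zero; suc; toℕ; fromℕ<; _≟_; combine; funToFin; finToFun)
import Data.Fin.Properties as Fin
open import Data.List using (List; []; _∷_; length; map; concatMap; _++_; filter; filterᵇ; allFin)
import Data.List as List
open import Data.List.Membership.Propositional using (_∈_; lose; find)
import Data.List.Membership.Propositional.Properties as ∈
import Data.List.Membership.DecPropositional as DecMembership
open import Data.List.Properties using (length-tabulate; length-map; length-filter; filter-all)
open import Data.List.Relation.Unary.Any using (Any; any?; here; there)
open import Data.List.Relation.Unary.All using (All)
import Data.List.Relation.Unary.All as All
import Data.List.Relation.Unary.All.Properties as All
open import Data.List.Relation.Unary.Unique.Propositional using (Unique; []; _∷_)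
import Data.List.Relation.Unary.Unique.Propositional.Properties as Unique
import Data.List.Relation.Unary.Unique.DecPropositional as DecUnique
open import Data.Nat using (ℕ; zero; suc; _+_; _*_; _∸_; _^_; _≤_; _<_; _≤?_; _<?_; z≤n; s≤s; NonZero; >-nonZero)
open import Data.Nat.DivMod using (_/_; _%_; m≡m%n+[m/n]*n; m%n<n; m/n*n≤m; m/n≤m; m*n/n≡m; /-monoˡ-≤)
open import Data.Nat.Properties hiding (_≟_)
open import Data.Nat.Tactic.RingSolver using (solve-∀)
open import Data.Product using (Σ; ∃; _×_; _,_; proj₁; proj₂)
open import Data.Vec using (Vec; []; _∷_; lookup; tabulate; head; toList; fromList)
import Data.Vec as Vec
import Data.Vec.Properties as Vec
open import Function using (_∘_; case_of_)
open import Relation.Binary.Definitions using (tri<; tri≈; tri>)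
open import Relation.Binary.PropositionalEquality
open import Relation.Nullary using (¬_; Dec; does; yes; no; contradiction; T?; ¬?; _×-dec_)
open import Relation.Nullary.Decidable using (decidable-stable)
open import Relation.Unary using (Decidable)

private variable
  A B : Set

-- Finite sums and counts

∑ : (A → ℕ) → List A → ℕ
∑ f []       = 0
∑ f (x ∷ xs) = f x + ∑ f xs

∑-cong : ∀ {f g : A → ℕ} xs → (∀ {x} → x ∈ xs → f x ≡ g x) → ∑ f xs ≡ ∑ g xs
∑-cong []       f≡g = refl
∑-cong (x ∷ xs) f≡g = cong₂ _+_ (f≡g (here refl)) (∑-cong xs (λ p → f≡g (there p)))

∑-mono : ∀ {f g : A → ℕ} xs → (∀ {x} → x ∈ xs → f x ≤ g x) → ∑ f xs ≤ ∑ g xs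
∑-mono []       f≤g = z≤n
∑-mono (x ∷ xs) f≤g = +-mono-≤ (f≤g (here refl)) (∑-mono xs (λ p → f≤g (there p)))

∑-const : ∀ c (xs : List A) → ∑ (λ _ → c) xs ≡ length xs * c
∑-const c []       = refl
∑-const c (x ∷ xs) = cong (c +_) (∑-const c xs)

∑-+ : ∀ (f g : A → ℕ) xs → ∑ (λ x → f x + g x) xs ≡ ∑ f xs + ∑ g xs
∑-+ f g []       = refl
∑-+ f g (x ∷ xs) = begin
  f x + g x + ∑ (λ x → f x + g x) xs ≡⟨ cong (f x + g x +_) (∑-+ f g xs) ⟩
  f x + g x + (∑ f xs + ∑ g xs)      ≡⟨ +-assoc (f x) (g x) _ ⟩
  f x + (g x + (∑ f xs + ∑ g xs))    ≡⟨ cong (f x +_) (x+[y+z]≡y+[x+z] (g x) (∑ f xs) (∑ g xs)) ⟩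
  f x + (∑ f xs + (g x + ∑ g xs))    ≡⟨ +-assoc (f x) (∑ f xs) _ ⟨
  f x + ∑ f xs + (g x + ∑ g xs)      ∎
  where
  open ≡-Reasoning
  x+[y+z]≡y+[x+z] : ∀ a b c → a + (b + c) ≡ b + (a + c)
  x+[y+z]≡y+[x+z] a b c = trans (sym (+-assoc a b c)) (trans (cong (_+ c) (+-comm a b)) (+-assoc b a c))

∑-*ˡ : ∀ c (f : A → ℕ) xs → ∑ (λ x → c * f x) xs ≡ c * ∑ f xs
∑-*ˡ c f []       = sym (*-zeroʳ c)
∑-*ˡ c f (x ∷ xs) = trans (cong (c * f x +_) (∑-*ˡ c f xs)) (sym (*-distribˡ-+ c (f x) (∑ f xs)))

∑-*ʳ : ∀ c (f : A → ℕ) xs → ∑ (λ x → f x * c) xs ≡ ∑ f xs * c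
∑-*ʳ c f xs = trans (∑-cong xs (λ {x} _ → *-comm (f x) c)) (trans (∑-*ˡ c f xs) (*-comm c (∑ f xs)))

∑-swap : ∀ (f : A → B → ℕ) xs ys → ∑ (λ x → ∑ (f x) ys) xs ≡ ∑ (λ y → ∑ (λ x → f x y) xs) ys
∑-swap f []       ys = sym (trans (∑-const 0 ys) (*-zeroʳ (length ys)))
∑-swap f (x ∷ xs) ys = trans (cong (∑ (f x) ys +_) (∑-swap f xs ys)) (sym (∑-+ (f x) _ ys))

∑-map : ∀ (f : B → ℕ) (g : A → B) xs → ∑ f (map g xs) ≡ ∑ (λ x → f (g x)) xs
∑-map f g []       = refl
∑-map f g (x ∷ xs) = cong (f (g x) +_) (∑-map f g xs)

∑-++ : ∀ (f : A → ℕ) xs ys → ∑ f (xs ++ ys) ≡ ∑ f xs + ∑ f ys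
∑-++ f []       ys = refl
∑-++ f (x ∷ xs) ys = trans (cong (f x +_) (∑-++ f xs ys)) (sym (+-assoc (f x) _ _))

∑-concatMap : ∀ (f : B → ℕ) (g : A → List B) xs → ∑ f (concatMap g xs) ≡ ∑ (λ x → ∑ f (g x)) xs
∑-concatMap f g []       = refl
∑-concatMap f g (x ∷ xs) = trans (∑-++ f (g x) (concatMap g xs)) (cong (∑ f (g x) +_) (∑-concatMap f g xs))

length≡∑1 : (xs : List A) → length xs ≡ ∑ (λ _ → 1) xs
length≡∑1 xs = sym (trans (∑-const 1 xs) (*-identityʳ (length xs)))

𝟙 : Bool → ℕ
𝟙 true  = 1
𝟙 false = 0

𝟙-∧ : ∀ a b → 𝟙 (a ∧ b) ≡ 𝟙 a * 𝟙 b
𝟙-∧ true  b = sym (+-identityʳ (𝟙 b))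
𝟙-∧ false b = refl

count : (A → Bool) → List A → ℕ
count p = ∑ (λ x → 𝟙 (p x))

length-filter≡count : ∀ {P : A → Set} (P? : Decidable P) xs → length (filter P? xs) ≡ count (λ x → does (P? x)) xs
length-filter≡count P? []       = refl
length-filter≡count P? (x ∷ xs) with does (P? x)
... | true  = cong suc (length-filter≡count P? xs)
... | false = length-filter≡count P? xs

length-filterᵇ : ∀ (p : A → Bool) xs → length (filterᵇ p xs) ≡ count p xs
length-filterᵇ p = length-filter≡count (λ x → T? (p x))

length≡filter+filter¬ : ∀ {P : A → Set} (P? : Decidable P) xs →
  length xs ≡ length (filter P? xs) + length (filter (λ x → ¬? (P? x)) xs)
length≡filter+filter¬ P? []       = refl
length≡filter+filter¬ P? (x ∷ xs) with does (P? x)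
... | true  = cong suc (length≡filter+filter¬ P? xs)
... | false = trans (cong suc (length≡filter+filter¬ P? xs)) (sym (+-suc _ _))

aboveAverage : (d : A) (f : A → ℕ) (xs : List A) → Σ A λ x → ∑ f xs ≤ length xs * f x
aboveAverage d f []       = d , z≤n
aboveAverage d f (x ∷ xs) with aboveAverage d f xs
... | y , ∑≤ with f x ≤? f y
...   | yes fx≤fy = y , +-mono-≤ fx≤fy ∑≤
...   | no  fx≰fy = x , +-monoʳ-≤ (f x) (≤-trans ∑≤ (*-monoʳ-≤ (length xs) (≰⇒≥ fx≰fy)))

count≤length : ∀ (p : A → Bool) xs → count p xs ≤ length xs
count≤length p xs = subst (count p xs ≤_) (sym (length≡∑1 xs)) (∑-mono xs (λ {x} _ → 𝟙≤1 (p x)))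
  where
  𝟙≤1 : ∀ b → 𝟙 b ≤ 1
  𝟙≤1 true  = s≤s z≤n
  𝟙≤1 false = z≤n

^-distribʳ-* : ∀ a b n → (a * b) ^ n ≡ a ^ n * b ^ n
^-distribʳ-* a b zero    = refl
^-distribʳ-* a b (suc n) = trans (cong (a * b *_) (^-distribʳ-* a b n)) (shuffle a b (a ^ n) (b ^ n))
  where
  shuffle : ∀ w x y z → w * x * (y * z) ≡ w * y * (x * z)
  shuffle = solve-∀

-- Distinct lists and enumerations of vectors

remove : ∀ {x : A} ys → x ∈ ys → List A
remove (y ∷ ys) (here _)  = ys
remove (y ∷ ys) (there p) = y ∷ remove ys p

length-remove : ∀ {x : A} ys (p : x ∈ ys) → length ys ≡ suc (length (remove ys p))
length-remove (y ∷ ys) (here _)  = refl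
length-remove (y ∷ ys) (there p) = cong suc (length-remove ys p)

∈-remove : ∀ {x z : A} ys (p : x ∈ ys) → z ∈ ys → x ≢ z → z ∈ remove ys p
∈-remove (y ∷ ys) (here refl) (here refl) x≢z = contradiction refl x≢z
∈-remove (y ∷ ys) (here _)    (there q)   x≢z = q
∈-remove (y ∷ ys) (there p)   (here z≡y)  x≢z = here z≡y
∈-remove (y ∷ ys) (there p)   (there q)   x≢z = there (∈-remove ys p q x≢z)

length-≤-injectiveOn : ∀ (f : A → B) {xs : List A} {ys : List B} → Unique xs →
  (∀ {x y} → x ∈ xs → y ∈ xs → f x ≡ f y → x ≡ y) → (∀ {x} → x ∈ xs → f x ∈ ys) →
  length xs ≤ length ys
length-≤-injectiveOn f {[]}     _             _   _  = z≤n
length-≤-injectiveOn f {x ∷ xs} {ys} (x∉xs ∷ u) inj ∈ys =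
  subst (suc (length xs) ≤_) (sym (length-remove ys fx∈ys))
    (s≤s (length-≤-injectiveOn f u (λ p q → inj (there p) (there q)) ∈ys′))
  where
  fx∈ys = ∈ys (here refl)
  ∈ys′ : ∀ {z} → z ∈ xs → f z ∈ remove ys fx∈ys
  ∈ys′ z∈xs = ∈-remove ys fx∈ys (∈ys (there z∈xs))
                (λ fx≡fz → All.lookup x∉xs z∈xs (inj (here refl) (there z∈xs) fx≡fz))

allVecs : List A → (n : ℕ) → List (Vec A n)
allVecs L zero    = [] ∷ []
allVecs L (suc n) = concatMap (λ a → map (a ∷_) (allVecs L n)) L

∈-allVecs : ∀ {L : List A} → (∀ a → a ∈ L) → ∀ {n} (v : Vec A n) → v ∈ allVecs L n
∈-allVecs L-complete []      = here refl
∈-allVecs L-complete (a ∷ v) =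
  ∈.∈-concat⁺′ (∈.∈-map⁺ (a ∷_) (∈-allVecs L-complete v)) (∈.∈-map⁺ _ (L-complete a))

count-allVecs-∷ : ∀ (L : List A) {n} (P : Vec A (suc n) → Bool) (p : A → Bool) (Q : Vec A n → Bool) →
  (∀ a v → P (a ∷ v) ≡ p a ∧ Q v) → count P (allVecs L (suc n)) ≡ count p L * count Q (allVecs L n)
count-allVecs-∷ L {n} P p Q P≡p∧Q = begin
  count P (concatMap (λ a → map (a ∷_) (allVecs L n)) L)
    ≡⟨ ∑-concatMap _ (λ a → map (a ∷_) (allVecs L n)) L ⟩
  ∑ (λ a → count P (map (a ∷_) (allVecs L n))) L
    ≡⟨ ∑-cong L (λ {a} _ → trans (∑-map _ (a ∷_) (allVecs L n)) (headFactor a)) ⟩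
  ∑ (λ a → 𝟙 (p a) * count Q (allVecs L n)) L
    ≡⟨ ∑-*ʳ (count Q (allVecs L n)) (λ a → 𝟙 (p a)) L ⟩
  count p L * count Q (allVecs L n) ∎
  where
  open ≡-Reasoning
  headFactor : ∀ a → ∑ (λ v → 𝟙 (P (a ∷ v))) (allVecs L n) ≡ 𝟙 (p a) * count Q (allVecs L n)
  headFactor a = trans (∑-cong (allVecs L n) (λ {v} _ → trans (cong 𝟙 (P≡p∧Q a v)) (𝟙-∧ (p a) (Q v))))
                       (∑-*ˡ (𝟙 (p a)) (λ v → 𝟙 (Q v)) (allVecs L n))

count-allVecs : ∀ (p : A → Bool) L n → count (λ v → all p (toList v)) (allVecs L n) ≡ count p L ^ n
count-allVecs p L zero    = refl
count-allVecs p L (suc n) = trans (count-allVecs-∷ L _ p _ (λ _ _ → refl)) (cong (count p L *_) (count-allVecs p L n))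

length-concatMap : ∀ (g : A → List B) xs → length (concatMap g xs) ≡ ∑ (λ x → length (g x)) xs
length-concatMap g xs = trans (length≡∑1 (concatMap g xs))
  (trans (∑-concatMap (λ _ → 1) g xs) (∑-cong xs (λ {x} _ → sym (length≡∑1 (g x)))))

length-allVecs : ∀ (L : List A) n → length (allVecs L n) ≡ length L ^ n
length-allVecs L zero    = refl
length-allVecs L (suc n) = begin
  length (concatMap (λ a → map (a ∷_) (allVecs L n)) L)   ≡⟨ length-concatMap _ L ⟩
  ∑ (λ a → length (map (a ∷_) (allVecs L n))) L            ≡⟨ ∑-cong L (λ {a} _ → length-map (a ∷_) (allVecs L n)) ⟩
  ∑ (λ _ → length (allVecs L n)) L                         ≡⟨ ∑-const _ L ⟩
  length L * length (allVecs L n)                          ≡⟨ cong (length L *_) (length-allVecs L n) ⟩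
  length L ^ suc n                                         ∎
  where open ≡-Reasoning

length-allFin : ∀ n → length (allFin n) ≡ n
length-allFin n = length-tabulate {n = n} (λ i → i)

allWords : ∀ q n → List (Word q n)
allWords q = allVecs (allFin q)

length-allWords : ∀ q n → length (allWords q n) ≡ q ^ n
length-allWords q n = trans (length-allVecs (allFin q) n) (cong (_^ n) (length-allFin q))

∈-allWords : ∀ {q n} (w : Word q n) → w ∈ allWords q n
∈-allWords = ∈-allVecs ∈.∈-allFin

-- Upper bound

pred≤length-filter-tabulate : ∀ {k} {P : A → Set} (P? : Decidable P) (f : Fin k → A) →
  (∀ j l → ¬ P (f j) → ¬ P (f l) → j ≡ l) → k ∸ 1 ≤ length (filter P? (List.tabulate f))
pred≤length-filter-tabulate {k = zero}  P? f _ = z≤n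
pred≤length-filter-tabulate {k = suc k} {P = P} P? f atMostOneFails with P? (f zero)
... | yes _  = ≤-trans (m≤n+m∸n k 1)
                 (s≤s (pred≤length-filter-tabulate P? (f ∘ suc) (λ j l p q → Fin.suc-injective (atMostOneFails _ _ p q))))
... | no ¬P₀ = ≤-reflexive (sym (trans (cong length (filter-all P? (All.tabulate⁺ rest))) (length-tabulate (f ∘ suc))))
  where
  rest : ∀ j → P (f (suc j))
  rest j = decidable-stable (P? (f (suc j))) (λ ¬P → Fin.0≢1+n (atMostOneFails zero (suc j) ¬P₀ ¬P))

_≟ʷ_ : ∀ {q n} → (x y : Word q n) → Dec (x ≡ y)
_≟ʷ_ = Vec.≡-dec Fin._≟_

lookup-≢ : ∀ {q n} {x y : Word q n} → x ≢ y → ∃ λ i → lookup x i ≢ lookup y i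
lookup-≢ {n = n} {x} {y} x≢y = Fin.¬∀⟶∃¬ n _ (λ i → lookup x i Fin.≟ lookup y i) (x≢y ∘ lookup-ext)
  where
  lookup-ext : (∀ i → lookup x i ≡ lookup y i) → x ≡ y
  lookup-ext eq = trans (sym (Vec.tabulate∘lookup x)) (trans (Vec.tabulate-cong eq) (Vec.tabulate∘lookup y))

module ProjectionBound {q n d k : ℕ}
  (π : Fin k → Word q n → Word q d)
  (InBlock : Fin k → Fin n → Set) (InBlock? : ∀ j i → Dec (InBlock j i))
  (π-agrees : ∀ j {x y} i → π j x ≡ π j y → ¬ InBlock j i → lookup x i ≡ lookup y i)
  (blocks-disjoint : ∀ {j l i} → InBlock j i → InBlock l i → j ≡ l)
  (F : Family q n) (F-unique : Unique F) (F-free : ¬ ContainsFocal (suc k) F)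
  where

  Twin : Fin k → Word q n → Word q n → Set
  Twin j x y = π j y ≡ π j x × y ≢ x

  HasTwin : Fin k → Word q n → Set
  HasTwin j x = Any (Twin j x) F

  hasTwin? : ∀ j x → Dec (HasTwin j x)
  hasTwin? j x = any? (λ y → (π j y ≟ʷ π j x) ×-dec ¬? (y ≟ʷ x)) F

  differs⇒InBlock : ∀ {j x y} i → π j y ≡ π j x → lookup y i ≢ lookup x i → InBlock j i
  differs⇒InBlock {j} i πy≡πx yᵢ≢xᵢ = decidable-stable (InBlock? j i) (yᵢ≢xᵢ ∘ π-agrees j i πy≡πx)

  twins⇒focal : ∀ {x} → x ∈ F → (∀ j → HasTwin j x) → ContainsFocal (suc k) F
  twins⇒focal {x} x∈F twins = x , ys , x∈F , All.tabulate⁺ (proj₁ ∘ proj₂ ∘ witness) , distinct , length-tabulate y , agree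
    where
    witness : ∀ j → ∃ λ y → y ∈ F × Twin j x y
    witness j = find (twins j)

    y : Fin k → Word q n
    y j = proj₁ (witness j)

    πy≡πx : ∀ j → π j (y j) ≡ π j x
    πy≡πx j = proj₁ (proj₂ (proj₂ (witness j)))

    y≢x : ∀ j → y j ≢ x
    y≢x j = proj₂ (proj₂ (proj₂ (witness j)))

    ys : List (Word q n)
    ys = List.tabulate y

    y-injective : ∀ {j l} → y j ≡ y l → j ≡ l
    y-injective {j} {l} yj≡yl with lookup-≢ (y≢x j)
    ... | i , differs = blocks-disjoint (differs⇒InBlock i (πy≡πx j) differs)
                          (differs⇒InBlock i (πy≡πx l) (subst (λ z → lookup z i ≢ lookup x i) yj≡yl differs))

    distinct : Unique (x ∷ ys)
    distinct = All.tabulate⁺ (λ j x≡yj → y≢x j (sym x≡yj)) ∷ Unique.tabulate⁺ y-injective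

    agree : ∀ i → k ∸ 1 ≤ agreeCount i x ys
    agree i = pred≤length-filter-tabulate (λ z → lookup z i Fin.≟ lookup x i) y
      (λ j l dj dl → blocks-disjoint (differs⇒InBlock i (πy≡πx j) dj) (differs⇒InBlock i (πy≡πx l) dl))

  Determined : Fin k → List (Word q n)
  Determined j = filter (λ x → ¬? (hasTwin? j x)) F

  length-Determined : ∀ j → length (Determined j) ≤ q ^ d
  length-Determined j = subst (length (Determined j) ≤_) (length-allWords q d)
    (length-≤-injectiveOn (π j) (Unique.filter⁺ (λ x → ¬? (hasTwin? j x)) F-unique) π-injective (λ _ → ∈-allWords _))
    where
    π-injective : ∀ {x y} → x ∈ Determined j → y ∈ Determined j → π j x ≡ π j y → x ≡ y
    π-injective {x} {y} x∈ y∈ πx≡πy with x ≟ʷ y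
    ... | yes x≡y = x≡y
    ... | no  x≢y = contradiction (lose (proj₁ (∈.∈-filter⁻ determined? {xs = F} x∈)) (πx≡πy , x≢y))
                                  (proj₂ (∈.∈-filter⁻ determined? {xs = F} y∈))
      where determined? = λ x → ¬? (hasTwin? j x)

  ∈-Determined : ∀ {x} → x ∈ F → x ∈ concatMap Determined (allFin k)
  ∈-Determined {x} x∈F with Fin.any? (λ j → ¬? (hasTwin? j x))
  ... | yes (j , determined) = ∈.∈-concat⁺′ (∈.∈-filter⁺ _ x∈F determined) (∈.∈-map⁺ Determined (∈.∈-allFin j))
  ... | no  ¬determined      = contradiction (twins⇒focal x∈F (λ j → decidable-stable (hasTwin? j x) (¬determined ∘ (j ,_)))) F-free

  length≤k*q^d : length F ≤ k * q ^ d
  length≤k*q^d = begin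
    length F                               ≤⟨ length-≤-injectiveOn (λ x → x) F-unique (λ _ _ eq → eq) ∈-Determined ⟩
    length (concatMap Determined (allFin k))   ≡⟨ length-concatMap Determined (allFin k) ⟩
    ∑ (λ j → length (Determined j)) (allFin k) ≤⟨ ∑-mono (allFin k) (λ {j} _ → length-Determined j) ⟩
    ∑ (λ _ → q ^ d) (allFin k)             ≡⟨ ∑-const (q ^ d) (allFin k) ⟩
    length (allFin k) * q ^ d              ≡⟨ cong (_* q ^ d) (length-allFin k) ⟩
    k * q ^ d                              ∎
    where open ≤-Reasoning

module BlockDeletion (n m : ℕ) (m≤n : m ≤ n) where

  InBlock : ℕ → Fin n → Set
  InBlock b i = b ≤ toℕ i × toℕ i < b + m

  inBlock? : ∀ b i → Dec (InBlock b i)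
  inBlock? b i = (b ≤? toℕ i) ×-dec (toℕ i <? b + m)

  -- skip b enumerates, in increasing order, the coordinates outside the block [b, b + m).
  skip : ℕ → Fin (n ∸ m) → Fin n
  skip b t with toℕ t <? b
  ... | yes _ = fromℕ< (<-≤-trans (Fin.toℕ<n t) (m∸n≤m n m))
  ... | no  _ = fromℕ< (m≤o∸n⇒m+n≤o (suc (toℕ t)) m≤n (Fin.toℕ<n t))

  toℕ-skip-< : ∀ {b} t → toℕ t < b → toℕ (skip b t) ≡ toℕ t
  toℕ-skip-< {b} t t<b with toℕ t <? b
  ... | yes _   = Fin.toℕ-fromℕ< _
  ... | no  t≮b = contradiction t<b t≮b

  toℕ-skip-≥ : ∀ {b} t → b ≤ toℕ t → toℕ (skip b t) ≡ toℕ t + m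
  toℕ-skip-≥ {b} t b≤t with toℕ t <? b
  ... | yes t<b = contradiction b≤t (<⇒≱ t<b)
  ... | no  _   = Fin.toℕ-fromℕ< _

  skip-onto : ∀ {b} → b + m ≤ n → ∀ i → ¬ InBlock b i → ∃ λ t → skip b t ≡ i
  skip-onto {b} b+m≤n i i∉ with toℕ i <? b
  ... | yes i<b = t , Fin.toℕ-injective (trans (toℕ-skip-< t (subst (_< b) (sym toℕt≡i) i<b)) toℕt≡i)
    where
    t = fromℕ< (<-≤-trans i<b (m+n≤o⇒m≤o∸n b b+m≤n))
    toℕt≡i = Fin.toℕ-fromℕ< _
  ... | no  i≮b = t , Fin.toℕ-injective (begin
      toℕ (skip b t)    ≡⟨ toℕ-skip-≥ t (subst (b ≤_) (sym toℕt≡i∸m) (m+n≤o⇒m≤o∸n b b+m≤i)) ⟩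
      toℕ t + m         ≡⟨ cong (_+ m) toℕt≡i∸m ⟩
      toℕ i ∸ m + m     ≡⟨ m∸n+n≡m (m+n≤o⇒n≤o b b+m≤i) ⟩
      toℕ i             ∎)
    where
    open ≡-Reasoning
    b+m≤i : b + m ≤ toℕ i
    b+m≤i with b + m ≤? toℕ i
    ... | yes le = le
    ... | no  gt = contradiction (≮⇒≥ i≮b , ≰⇒> gt) i∉
    t = fromℕ< (∸-monoˡ-< (Fin.toℕ<n i) (m+n≤o⇒n≤o b b+m≤i))
    toℕt≡i∸m = Fin.toℕ-fromℕ< _

  delete : ∀ {A : Set} → ℕ → Vec A n → Vec A (n ∸ m)
  delete b x = tabulate (λ t → lookup x (skip b t))

  delete-agrees : ∀ {A : Set} {b} → b + m ≤ n → ∀ {x y : Vec A n} i →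
    delete b x ≡ delete b y → ¬ InBlock b i → lookup x i ≡ lookup y i
  delete-agrees {b = b} b+m≤n {x} {y} i eq i∉ with skip-onto b+m≤n i i∉
  ... | t , refl = begin
    lookup x (skip b t)      ≡⟨ Vec.lookup∘tabulate _ t ⟨
    lookup (delete b x) t    ≡⟨ cong (λ v → lookup v t) eq ⟩
    lookup (delete b y) t    ≡⟨ Vec.lookup∘tabulate _ t ⟩
    lookup y (skip b t)      ∎
    where open ≡-Reasoning

n∸n/[1+k]≤[k*n+k]/[1+k] : ∀ k′ n → n ∸ n / suc k′ ≤ (k′ * n + k′) / suc k′
n∸n/[1+k]≤[k*n+k]/[1+k] k′ n = subst (_≤ (k′ * n + k′) / k) (m*n/n≡m (n ∸ m) k) (/-monoˡ-≤ k [n∸m]*k≤k′*n+k′)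
  where
  k = suc k′
  m = n / k
  s = n % k
  n≡s+m*k : n ≡ s + m * k
  n≡s+m*k = m≡m%n+[m/n]*n n k
  n∸m≡s+m*k′ : n ∸ m ≡ s + m * k′
  n∸m≡s+m*k′ = trans (cong (_∸ m) (trans n≡s+m*k (regroup s m k′))) (m+n∸m≡n m (s + m * k′))
    where
    regroup : ∀ s m k′ → s + m * suc k′ ≡ m + (s + m * k′)
    regroup = solve-∀
  [n∸m]*k≤k′*n+k′ : (n ∸ m) * k ≤ k′ * n + k′
  [n∸m]*k≤k′*n+k′ = begin
    (n ∸ m) * k              ≡⟨ cong (_* k) n∸m≡s+m*k′ ⟩
    (s + m * k′) * suc k′    ≡⟨ expand s m k′ ⟩
    s + k′ * (s + m * k)     ≤⟨ +-monoˡ-≤ _ (≤-pred (m%n<n n k)) ⟩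
    k′ + k′ * (s + m * k)    ≡⟨ cong (λ z → k′ + k′ * z) n≡s+m*k ⟨
    k′ + k′ * n              ≡⟨ +-comm k′ (k′ * n) ⟩
    k′ * n + k′              ∎
    where
    open ≤-Reasoning
    expand : ∀ s m k′ → (s + m * k′) * suc k′ ≡ s + k′ * (s + m * suc k′)
    expand = solve-∀

upperBound : ∀ q k′ n .{{_ : NonZero q}} (F : Family q n) → Unique F → ¬ ContainsFocal (suc (suc k′)) F →
  length F ≤ suc k′ * q ^ ((k′ * n + k′) / suc k′)
upperBound q k′ n F F-unique F-free = ≤-trans
  (ProjectionBound.length≤k*q^d (λ j → delete (block j)) (λ j → InBlock (block j)) (λ j → inBlock? (block j))
     (λ j {x} {y} i → delete-agrees (block-fits j) {x} {y} i) blocks-disjoint F F-unique F-free)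
  (*-monoʳ-≤ k (^-monoʳ-≤ q (n∸n/[1+k]≤[k*n+k]/[1+k] k′ n)))
  where
  k = suc k′
  m = n / k
  open BlockDeletion n m (m/n≤m n k)

  block : Fin k → ℕ
  block j = toℕ j * m

  block-fits : ∀ j → block j + m ≤ n
  block-fits j = begin
    toℕ j * m + m   ≡⟨ +-comm (toℕ j * m) m ⟩
    suc (toℕ j) * m ≤⟨ *-monoˡ-≤ m (Fin.toℕ<n j) ⟩
    k * m           ≡⟨ *-comm k m ⟩
    m * k           ≤⟨ m/n*n≤m n k ⟩
    n               ∎
    where open ≤-Reasoning

  block-before : ∀ {j l} → toℕ j < toℕ l → block j + m ≤ block l
  block-before {j} j<l = ≤-trans (≤-reflexive (+-comm (toℕ j * m) m)) (*-monoˡ-≤ m j<l)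

  blocks-disjoint : ∀ {j l i} → InBlock (block j) i → InBlock (block l) i → j ≡ l
  blocks-disjoint {j} {l} (j≤i , i<j+m) (l≤i , i<l+m) with <-cmp (toℕ j) (toℕ l)
  ... | tri< j<l _ _ = contradiction (≤-trans (block-before j<l) l≤i) (<⇒≱ i<j+m)
  ... | tri≈ _ j≡l _ = Fin.toℕ-injective j≡l
  ... | tri> _ _ l<j = contradiction (≤-trans (block-before l<j) j≤i) (<⇒≱ i<l+m)

-- Random colourings and the alteration method

module Colourings (M₀ : ℕ) where

  M : ℕ
  M = suc M₀

  isZero : Fin M → Bool
  isZero zero    = true
  isZero (suc _) = false

  zeroOn : ∀ {N} → Vec (Fin M) N → List (Fin N) → Bool
  zeroOn h = all (λ i → isZero (lookup h i))

  colourings : ∀ N → List (Vec (Fin M) N)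
  colourings = allVecs (allFin M)

  has0 : ∀ {N} → List (Fin (suc N)) → Bool
  has0 []          = false
  has0 (zero  ∷ I) = true
  has0 (suc _ ∷ I) = has0 I

  preds : ∀ {N} → List (Fin (suc N)) → List (Fin N)
  preds []          = []
  preds (zero  ∷ I) = preds I
  preds (suc i ∷ I) = i ∷ preds I

  zeroOn-∷ : ∀ {N} c (h : Vec (Fin M) N) I → zeroOn (c ∷ h) I ≡ (not (has0 I) ∨ isZero c) ∧ zeroOn h (preds I)
  zeroOn-∷ c h []          = refl
  zeroOn-∷ c h (zero  ∷ I) rewrite zeroOn-∷ c h I with isZero c
  ... | true  = cong (_∧ zeroOn h (preds I)) (∨-zeroʳ (not (has0 I)))
  ... | false = refl
  zeroOn-∷ c h (suc i ∷ I) rewrite zeroOn-∷ c h I =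
    trans (sym (∧-assoc a g r)) (trans (cong (_∧ r) (∧-comm a g)) (∧-assoc g a r))
    where
    a = isZero (lookup h i)
    g = not (has0 I) ∨ isZero c
    r = zeroOn h (preds I)

  ∈-preds⁻ : ∀ {N} {i : Fin N} I → i ∈ preds I → suc i ∈ I
  ∈-preds⁻ (zero  ∷ I) p         = there (∈-preds⁻ I p)
  ∈-preds⁻ (suc j ∷ I) (here refl) = here refl
  ∈-preds⁻ (suc j ∷ I) (there p)   = there (∈-preds⁻ I p)

  has0⇒∈ : ∀ {N} (I : List (Fin (suc N))) → T (has0 I) → zero ∈ I
  has0⇒∈ (zero  ∷ I) _ = here refl
  has0⇒∈ (suc _ ∷ I) t = there (has0⇒∈ I t)

  preds-unique : ∀ {N} {I : List (Fin (suc N))} → Unique I → Unique (preds I)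
  preds-unique {I = []}        []        = []
  preds-unique {I = zero  ∷ I} (_ ∷ u)   = preds-unique u
  preds-unique {I = suc i ∷ I} (i∉ ∷ u)  =
    All.tabulate {xs = preds I} (λ p i≡ → All.lookup i∉ (∈-preds⁻ I p) (cong suc i≡)) ∷ preds-unique u

  length-preds : ∀ {N} {I : List (Fin (suc N))} → Unique I → length I ≡ 𝟙 (has0 I) + length (preds I)
  length-preds {I = []}        []       = refl
  length-preds {I = zero  ∷ I} (0∉ ∷ u) with has0 I in eq
  ... | true  = contradiction refl (All.lookup 0∉ (has0⇒∈ I (subst T (sym eq) _)))
  ... | false = cong suc (trans (length-preds u) (cong (λ b → 𝟙 b + length (preds I)) eq))
  length-preds {I = suc i ∷ I} (_ ∷ u)  = trans (cong suc (length-preds u)) (sym (+-suc (𝟙 (has0 I)) _))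

  count-isZero : count isZero (allFin M) ≡ 1
  count-isZero = cong suc (trans (∑-cong nonzeros isZero≡0) (trans (∑-const 0 nonzeros) (*-zeroʳ (length nonzeros))))
    where
    nonzeros = List.tabulate {n = M₀} suc
    isZero≡0 : ∀ {c} → c ∈ nonzeros → 𝟙 (isZero c) ≡ 0
    isZero≡0 c∈ with ∈.∈-tabulate⁻ c∈
    ... | _ , refl = refl

  count-has0 : ∀ {N} (I : List (Fin (suc N))) → count (λ c → not (has0 I) ∨ isZero c) (allFin M) ≡ M ^ 𝟙 (not (has0 I))
  count-has0 I with has0 I
  ... | true  = count-isZero
  ... | false = trans (sym (length≡∑1 (allFin M))) (trans (length-allFin M) (sym (*-identityʳ M)))

  count-zeroOn : ∀ N {I : List (Fin N)} → Unique I → count (λ h → zeroOn h I) (colourings N) * M ^ length I ≡ M ^ N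
  count-zeroOn zero    {[]} [] = refl
  count-zeroOn (suc N) {I}  u  = begin
    count (λ h → zeroOn h I) (colourings (suc N)) * M ^ length I
      ≡⟨ cong₂ (λ a b → a * M ^ b)
           (count-allVecs-∷ (allFin M) _ (λ c → not z ∨ isZero c) (λ h → zeroOn h (preds I)) (λ c h → zeroOn-∷ c h I))
           (length-preds u) ⟩
    count (λ c → not z ∨ isZero c) (allFin M) * S′ * M ^ (𝟙 z + length (preds I))
      ≡⟨ cong (λ a → a * S′ * M ^ (𝟙 z + length (preds I))) (count-has0 I) ⟩
    M ^ 𝟙 (not z) * S′ * M ^ (𝟙 z + length (preds I))
      ≡⟨ regroup (𝟙 (not z)) (𝟙 z) (length (preds I)) ⟩
    M ^ (𝟙 (not z) + 𝟙 z) * (S′ * M ^ length (preds I))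
      ≡⟨ cong₂ (λ a b → M ^ a * b) (𝟙-not+𝟙 z) (count-zeroOn N (preds-unique u)) ⟩
    M ^ 1 * M ^ N
      ≡⟨ cong (_* M ^ N) (*-identityʳ M) ⟩
    M * M ^ N ∎
    where
    open ≡-Reasoning
    z  = has0 I
    S′ = count (λ h → zeroOn h (preds I)) (colourings N)
    regroup : ∀ a b c → M ^ a * S′ * M ^ (b + c) ≡ M ^ (a + b) * (S′ * M ^ c)
    regroup a b c = begin
      M ^ a * S′ * M ^ (b + c)         ≡⟨ cong (M ^ a * S′ *_) (^-distribˡ-+-* M b c) ⟩
      M ^ a * S′ * (M ^ b * M ^ c)     ≡⟨ shuffle (M ^ a) S′ (M ^ b) (M ^ c) ⟩
      M ^ a * M ^ b * (S′ * M ^ c)     ≡⟨ cong (_* (S′ * M ^ c)) (^-distribˡ-+-* M a b) ⟨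
      M ^ (a + b) * (S′ * M ^ c)       ∎
      where
      shuffle : ∀ w x y z → w * x * (y * z) ≡ w * y * (x * z)
      shuffle = solve-∀
    𝟙-not+𝟙 : ∀ b → 𝟙 (not b) + 𝟙 b ≡ 1
    𝟙-not+𝟙 true  = refl
    𝟙-not+𝟙 false = refl

module Alteration (M₀ N k : ℕ) (C : List (Vec (Fin N) (suc k)))
                  (C-unique : ∀ {t} → t ∈ C → Unique (toList t)) where
  open Colourings M₀
  open DecMembership (Data.Fin._≟_ {N}) using (_∈?_)

  inside : Vec (Fin M) N → List (Fin N)
  inside h = filterᵇ (λ i → isZero (lookup h i)) (allFin N)

  hit : Vec (Fin M) N → List (Vec (Fin N) (suc k))
  hit h = filterᵇ (λ t → zeroOn h (toList t)) C

  survivors : Vec (Fin M) N → List (Fin N)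
  survivors h = filter (λ i → ¬? (i ∈? map head (hit h))) (inside h)

  inside-unique : ∀ h → Unique (inside h)
  inside-unique h = Unique.filter⁺ _ (Unique.allFin⁺ N)

  survivors-unique : ∀ h → Unique (survivors h)
  survivors-unique h = Unique.filter⁺ _ (inside-unique h)

  survivors-avoid : ∀ h {t} → t ∈ C → ¬ All (_∈ survivors h) (toList t)
  survivors-avoid h {t@(a ∷ _)} t∈C t⊆survivors = proj₂ (∈.∈-filter⁻ survives? {xs = inside h} (All.head t⊆survivors)) head∈
    where
    survives? = λ i → ¬? (i ∈? map head (hit h))
    zero-on-t : T (zeroOn h (toList t))
    zero-on-t = All.all⁻ _ (All.map (λ i∈ → proj₂ (∈.∈-filter⁻ (λ i → T? (isZero (lookup h i))) {xs = allFin N}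
                                                 (proj₁ (∈.∈-filter⁻ survives? {xs = inside h} i∈))))
                                     t⊆survivors)
    head∈ : a ∈ map head (hit h)
    head∈ = ∈.∈-map⁺ head (∈.∈-filter⁺ (λ t → T? (zeroOn h (toList t))) t∈C zero-on-t)

  length-inside : ∀ h → length (inside h) ≤ length (survivors h) + length (hit h)
  length-inside h = begin
    length (inside h)                               ≡⟨ length≡filter+filter¬ _∈heads? (inside h) ⟩
    length (filter _∈heads? (inside h)) + length (survivors h)
                                                    ≤⟨ +-monoˡ-≤ _ heads-bound ⟩
    length (hit h) + length (survivors h)           ≡⟨ +-comm (length (hit h)) _ ⟩
    length (survivors h) + length (hit h)           ∎
    where
    open ≤-Reasoning
    _∈heads? = λ i → i ∈? map head (hit h)
    heads-bound : length (filter _∈heads? (inside h)) ≤ length (hit h)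
    heads-bound = subst (length (filter _∈heads? (inside h)) ≤_) (length-map head (hit h))
      (length-≤-injectiveOn (λ i → i) (Unique.filter⁺ _∈heads? (inside-unique h)) (λ _ _ eq → eq)
        (λ i∈ → proj₂ (∈.∈-filter⁻ _∈heads? {xs = inside h} i∈)))

  ∑-inside : ∑ (λ h → length (inside h)) (colourings N) * M ≡ N * M ^ N
  ∑-inside = begin
    ∑ (λ h → length (inside h)) (colourings N) * M
      ≡⟨ cong (_* M) (∑-cong (colourings N) (λ {h} _ → length-filterᵇ _ (allFin N))) ⟩
    ∑ (λ h → count (λ i → isZero (lookup h i)) (allFin N)) (colourings N) * M
      ≡⟨ cong (_* M) (∑-swap _ (colourings N) (allFin N)) ⟩
    ∑ (λ i → count (λ h → isZero (lookup h i)) (colourings N)) (allFin N) * M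
      ≡⟨ ∑-*ʳ M _ (allFin N) ⟨
    ∑ (λ i → count (λ h → isZero (lookup h i)) (colourings N) * M) (allFin N)
      ≡⟨ ∑-cong (allFin N) (λ {i} _ → trans (cong₂ _*_ (singleton i) (sym (*-identityʳ M))) (count-zeroOn N (∷-unique i))) ⟩
    ∑ (λ _ → M ^ N) (allFin N)
      ≡⟨ ∑-const (M ^ N) (allFin N) ⟩
    length (allFin N) * M ^ N
      ≡⟨ cong (_* M ^ N) (length-allFin N) ⟩
    N * M ^ N ∎
    where
    open ≡-Reasoning
    singleton : ∀ i → count (λ h → isZero (lookup h i)) (colourings N) ≡ count (λ h → zeroOn h (i ∷ [])) (colourings N)
    singleton i = ∑-cong (colourings N) (λ {h} _ → cong 𝟙 (sym (∧-identityʳ (isZero (lookup h i)))))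
    ∷-unique : ∀ (i : Fin N) → Unique (i ∷ [])
    ∷-unique i = All.[] ∷ []

  ∑-hit : ∑ (λ h → length (hit h)) (colourings N) * M ^ suc k ≡ length C * M ^ N
  ∑-hit = begin
    ∑ (λ h → length (hit h)) (colourings N) * M ^ suc k
      ≡⟨ cong (_* M ^ suc k) (∑-cong (colourings N) (λ {h} _ → length-filterᵇ _ C)) ⟩
    ∑ (λ h → count (λ t → zeroOn h (toList t)) C) (colourings N) * M ^ suc k
      ≡⟨ cong (_* M ^ suc k) (∑-swap _ (colourings N) C) ⟩
    ∑ (λ t → count (λ h → zeroOn h (toList t)) (colourings N)) C * M ^ suc k
      ≡⟨ ∑-*ʳ (M ^ suc k) _ C ⟨
    ∑ (λ t → count (λ h → zeroOn h (toList t)) (colourings N) * M ^ suc k) C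
      ≡⟨ ∑-cong C (λ {t} t∈C → trans (cong (λ l → count (λ h → zeroOn h (toList t)) (colourings N) * M ^ l) (sym (Vec.length-toList t)))
                                      (count-zeroOn N (C-unique t∈C))) ⟩
    ∑ (λ _ → M ^ N) C
      ≡⟨ ∑-const (M ^ N) C ⟩
    length C * M ^ N ∎
    where open ≡-Reasoning

  -- The averaging bound |G| ≥ N/M − |C|/M^(k+1), multiplied out to stay in ℕ.
  alteration : Σ (List (Fin N)) λ G → Unique G × (∀ {t} → t ∈ C → ¬ All (_∈ G) (toList t)) ×
                 N * M ^ k ≤ length G * M ^ suc k + length C
  alteration = survivors h* , survivors-unique h* , survivors-avoid h* , *-cancelʳ-≤ _ _ (M ^ N) {{m^n≢0 M N}} chain
    where
    best = aboveAverage (Vec.replicate N zero) (λ h → length (survivors h)) (colourings N)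
    h* = proj₁ best
    G* = length (survivors h*)
    chain : N * M ^ k * M ^ N ≤ (G* * M ^ suc k + length C) * M ^ N
    chain = begin
      N * M ^ k * M ^ N
        ≡⟨ swap₂₃ N (M ^ k) (M ^ N) ⟩
      N * M ^ N * M ^ k
        ≡⟨ cong (_* M ^ k) ∑-inside ⟨
      ∑ (λ h → length (inside h)) (colourings N) * M * M ^ k
        ≡⟨ *-assoc (∑ (λ h → length (inside h)) (colourings N)) M (M ^ k) ⟩
      ∑ (λ h → length (inside h)) (colourings N) * M ^ suc k
        ≤⟨ *-monoˡ-≤ (M ^ suc k) (∑-mono (colourings N) (λ {h} _ → length-inside h)) ⟩
      ∑ (λ h → length (survivors h) + length (hit h)) (colourings N) * M ^ suc k
        ≡⟨ cong (_* M ^ suc k) (∑-+ (λ h → length (survivors h)) (λ h → length (hit h)) (colourings N)) ⟩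
      (∑ (λ h → length (survivors h)) (colourings N) + ∑ (λ h → length (hit h)) (colourings N)) * M ^ suc k
        ≡⟨ trans (*-distribʳ-+ (M ^ suc k) (∑ (λ h → length (survivors h)) (colourings N)) _)
                 (cong (∑ (λ h → length (survivors h)) (colourings N) * M ^ suc k +_) ∑-hit) ⟩
      ∑ (λ h → length (survivors h)) (colourings N) * M ^ suc k + length C * M ^ N
        ≤⟨ +-monoˡ-≤ (length C * M ^ N) (*-monoˡ-≤ (M ^ suc k) (proj₂ best)) ⟩
      length (colourings N) * G* * M ^ suc k + length C * M ^ N
        ≡⟨ cong (λ x → x * G* * M ^ suc k + length C * M ^ N) (trans (length-allVecs (allFin M) N) (cong (_^ N) (length-allFin M))) ⟩
      M ^ N * G* * M ^ suc k + length C * M ^ N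
        ≡⟨ collect (M ^ N) G* (M ^ suc k) (length C) ⟩
      (G* * M ^ suc k + length C) * M ^ N ∎
      where
      open ≤-Reasoning
      swap₂₃ : ∀ n a b → n * a * b ≡ n * b * a
      swap₂₃ = solve-∀
      collect : ∀ p g a c → p * g * a + c * p ≡ (g * a + c) * p
      collect = solve-∀

-- Focal configurations

module _ {q : ℕ} where

  _==_ : Fin q → Fin q → Bool
  a == b = does (a ≟ b)

  atMostOneDiffers : Fin q → List (Fin q) → Bool
  atMostOneDiffers a []       = true
  atMostOneDiffers a (b ∷ bs) = if b == a then atMostOneDiffers a bs else all (_== a) bs

  focalColumn : ∀ {k} → Vec (Fin q) (suc k) → Bool
  focalColumn (a ∷ bs) = atMostOneDiffers a (toList bs)

  count-== : ∀ a → count (_== a) (allFin q) ≤ 1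
  count-== a = subst (_≤ 1) (length-filter≡count (_≟ a) (allFin q))
    (length-≤-injectiveOn (λ b → b) {ys = a ∷ []} (Unique.filter⁺ (_≟ a) (Unique.allFin⁺ q)) (λ _ _ eq → eq)
      (λ b∈ → here (proj₂ (∈.∈-filter⁻ (_≟ a) {xs = allFin q} b∈))))

  all-==-from : ∀ a bs → length bs ≤ count (_== a) bs → T (all (_== a) bs)
  all-==-from a []       _  = _
  all-==-from a (b ∷ bs) le with b ≟ a
  ... | yes _ = all-==-from a bs (≤-pred le)
  ... | no  _ = contradiction (count≤length (_== a) bs) (<⇒≱ le)

  atMostOneDiffers-from : ∀ a bs → length bs ∸ 1 ≤ count (_== a) bs → T (atMostOneDiffers a bs)
  atMostOneDiffers-from a []       _  = _
  atMostOneDiffers-from a (b ∷ bs) le with b ≟ a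
  ... | yes _ = atMostOneDiffers-from a bs (∸-monoˡ-≤ 1 le)
  ... | no  _ = all-==-from a bs le

module ColumnCount (q₀ : ℕ) where

  q : ℕ
  q = suc q₀

  allColumns : ∀ m → List (Vec (Fin q) m)
  allColumns = allVecs (allFin q)

  count-atMostOneDiffers : ∀ m a → count (λ bs → atMostOneDiffers a (toList bs)) (allColumns m) ≤ q₀ * m + 1
  count-atMostOneDiffers zero    a = ≤-reflexive (cong (_+ 1) (sym (*-zeroʳ q₀)))
  count-atMostOneDiffers (suc m) a = begin
    count (λ bs → atMostOneDiffers a (toList bs)) (allColumns (suc m))
      ≡⟨ ∑-concatMap _ (λ b → map (b ∷_) (allColumns m)) (allFin q) ⟩
    ∑ (λ b → count (λ bs → atMostOneDiffers a (toList bs)) (map (b ∷_) (allColumns m))) (allFin q)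
      ≡⟨ ∑-cong (allFin q) (λ {b} _ → ∑-map _ (b ∷_) (allColumns m)) ⟩
    ∑ (λ b → count (λ bs → atMostOneDiffers a (b ∷ toList bs)) (allColumns m)) (allFin q)
      ≤⟨ ∑-mono (allFin q) (λ {b} _ → byHead b) ⟩
    ∑ (λ b → 𝟙 (b == a) * (q₀ * m) + 1) (allFin q)
      ≡⟨ trans (∑-+ (λ b → 𝟙 (b == a) * (q₀ * m)) (λ _ → 1) (allFin q))
           (cong₂ _+_ (∑-*ʳ (q₀ * m) (λ b → 𝟙 (b == a)) (allFin q)) (trans (sym (length≡∑1 (allFin q))) (length-allFin q))) ⟩
    count (_== a) (allFin q) * (q₀ * m) + q
      ≤⟨ +-monoˡ-≤ q (*-monoˡ-≤ (q₀ * m) (count-== a)) ⟩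
    1 * (q₀ * m) + q
      ≡⟨ regroup q₀ m ⟩
    q₀ * suc m + 1 ∎
    where
    open ≤-Reasoning
    regroup : ∀ q₀ m → 1 * (q₀ * m) + suc q₀ ≡ q₀ * suc m + 1
    regroup = solve-∀
    byHead : ∀ b → count (λ bs → atMostOneDiffers a (b ∷ toList bs)) (allColumns m) ≤ 𝟙 (b == a) * (q₀ * m) + 1
    byHead b with b ≟ a
    ... | yes _ = subst (λ x → count (λ bs → atMostOneDiffers a (toList bs)) (allColumns m) ≤ x + 1)
                        (sym (*-identityˡ (q₀ * m))) (count-atMostOneDiffers m a)
    ... | no  _ = begin
      count (λ bs → all (_== a) (toList bs)) (allColumns m) ≡⟨ count-allVecs (_== a) (allFin q) m ⟩
      count (_== a) (allFin q) ^ m                        ≤⟨ ^-monoˡ-≤ m (count-== a) ⟩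
      1 ^ m                                               ≡⟨ ^-zeroˡ m ⟩
      1                                                   ∎

  count-focalColumn : ∀ k → count focalColumn (allColumns (suc k)) ≤ q * (q₀ * k + 1)
  count-focalColumn k = begin
    count focalColumn (allColumns (suc k))
      ≡⟨ ∑-concatMap _ (λ a → map (a ∷_) (allColumns k)) (allFin q) ⟩
    ∑ (λ a → count focalColumn (map (a ∷_) (allColumns k))) (allFin q)
      ≡⟨ ∑-cong (allFin q) (λ {a} _ → ∑-map _ (a ∷_) (allColumns k)) ⟩
    ∑ (λ a → count (λ bs → atMostOneDiffers a (toList bs)) (allColumns k)) (allFin q)
      ≤⟨ ∑-mono (allFin q) (λ {a} _ → count-atMostOneDiffers k a) ⟩
    ∑ (λ _ → q₀ * k + 1) (allFin q)
      ≡⟨ trans (∑-const _ (allFin q)) (cong (_* (q₀ * k + 1)) (length-allFin q)) ⟩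
    q * (q₀ * k + 1) ∎
    where open ≤-Reasoning

  count-focalTuple : ∀ k n → count (λ t → all focalColumn (toList t)) (allVecs (allColumns (suc k)) n) ≤ q ^ n * (q₀ * k + 1) ^ n
  count-focalTuple k n = begin
    count (λ t → all focalColumn (toList t)) (allVecs (allColumns (suc k)) n) ≡⟨ count-allVecs focalColumn (allColumns (suc k)) n ⟩
    count focalColumn (allColumns (suc k)) ^ n                                 ≤⟨ ^-monoˡ-≤ n (count-focalColumn k) ⟩
    (q * (q₀ * k + 1)) ^ n                                                  ≡⟨ ^-distribʳ-* q (q₀ * k + 1) n ⟩
    q ^ n * (q₀ * k + 1) ^ n                                                ∎
    where open ≤-Reasoning

encode : ∀ {q n} → Word q n → Fin (q ^ n)
encode w = funToFin (lookup w)

decode : ∀ {q n} → Fin (q ^ n) → Word q n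
decode i = tabulate (finToFun i)

funToFin-cong : ∀ {q n} {f g : Fin n → Fin q} → (∀ i → f i ≡ g i) → funToFin f ≡ funToFin g
funToFin-cong {n = zero}  f≗g = refl
funToFin-cong {n = suc n} f≗g = cong₂ combine (f≗g zero) (funToFin-cong (f≗g ∘ suc))

decode-encode : ∀ {q n} (w : Word q n) → decode (encode w) ≡ w
decode-encode w = trans (Vec.tabulate-cong (Fin.finToFun-funToFin (lookup w))) (Vec.tabulate∘lookup w)

encode-decode : ∀ {q n} (i : Fin (q ^ n)) → encode {q} {n} (decode i) ≡ i
encode-decode {q} {n} i = trans (funToFin-cong (Vec.lookup∘tabulate (finToFun {q} {n} i))) (Fin.funToFin-finToFin {n} {q} i)

encode-injective : ∀ {q n} {x y : Word q n} → encode x ≡ encode y → x ≡ y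
encode-injective {x = x} {y} eq = trans (sym (decode-encode x)) (trans (cong decode eq) (decode-encode y))

decode-injective : ∀ {q n} {i j : Fin (q ^ n)} → decode {q} {n} i ≡ decode j → i ≡ j
decode-injective {q} {n} {i} {j} eq = trans (sym (encode-decode {q} {n} i)) (trans (cong encode eq) (encode-decode {q} {n} j))

-- An m-tuple of words is also stored as its n columns; in that form the focal tuples are a
-- product set, which count-allVecs counts.
rows : ∀ {q n m} → Vec (Vec (Fin q) m) n → Vec (Word q n) m
rows t = tabulate (λ j → tabulate (λ i → lookup (lookup t i) j))

fromRows : ∀ {q n m} → Vec (Word q n) m → Vec (Vec (Fin q) m) n
fromRows ws = tabulate (λ i → Vec.map (λ w → lookup w i) ws)

rows-fromRows : ∀ {q n m} (ws : Vec (Word q n) m) → rows (fromRows ws) ≡ ws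
rows-fromRows ws = trans (Vec.tabulate-cong row-j) (Vec.tabulate∘lookup ws)
  where
  row-j : ∀ j → tabulate (λ i → lookup (lookup (fromRows ws) i) j) ≡ lookup ws j
  row-j j = trans (Vec.tabulate-cong (λ i →
              trans (cong (λ c → lookup c j) (Vec.lookup∘tabulate _ i)) (Vec.lookup-map j (λ w → lookup w i) ws)))
            (Vec.tabulate∘lookup (lookup ws j))

toList∘tabulate : ∀ {A : Set} {n} (f : Fin n → A) → toList (tabulate f) ≡ List.tabulate f
toList∘tabulate {n = zero}  f = refl
toList∘tabulate {n = suc n} f = cong (f zero ∷_) (toList∘tabulate (f ∘ suc))

focal⇒focalTuple : ∀ {q n k} {x₀ : Word q n} {ys} → IsFocal (suc k) x₀ ys →
  Σ (Vec (Vec (Fin q) (suc k)) n) λ t → T (all focalColumn (toList t)) × toList (rows t) ≡ x₀ ∷ ys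
focal⇒focalTuple {x₀ = x₀} {ys} (_ , refl , agree) =
  fromRows ws , subst (T ∘ all focalColumn) (sym (toList∘tabulate column)) (All.all⁻ focalColumn (All.tabulate⁺ focal-i)) ,
  trans (cong toList (rows-fromRows ws)) (cong (x₀ ∷_) (Vec.toList∘fromList ys))
  where
  ws = x₀ ∷ fromList ys
  column = λ i → Vec.map (λ w → lookup w i) ws
  focal-i : ∀ i → T (focalColumn (column i))
  focal-i i = subst (T ∘ atMostOneDiffers (lookup x₀ i)) (sym entries)
    (atMostOneDiffers-from (lookup x₀ i) (List.map (λ y → lookup y i) ys)
      (subst₂ (λ l c → l ∸ 1 ≤ c) (sym (length-map _ ys)) agreeCount≡ (agree i)))
    where
    entries : toList (Vec.map (λ y → lookup y i) (fromList ys)) ≡ List.map (λ y → lookup y i) ys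
    entries = trans (Vec.toList-map _ (fromList ys)) (cong (List.map _) (Vec.toList∘fromList ys))
    agreeCount≡ : agreeCount i x₀ ys ≡ count (_== lookup x₀ i) (List.map (λ y → lookup y i) ys)
    agreeCount≡ = trans (length-filter≡count (λ y → lookup y i ≟ lookup x₀ i) ys) (sym (∑-map _ (λ y → lookup y i) ys))

-- Lower bound

module LowerBound (q₀ k n M₀ : ℕ) where
  open ColumnCount q₀ using (q; allColumns; count-focalTuple)
  open Colourings M₀ using (M)

  N : ℕ
  N = q ^ n

  K : ℕ
  K = q₀ * k + 1

  open DecUnique (Fin._≟_ {N}) using (unique?)

  focalTuples : List (Vec (Vec (Fin q) (suc k)) n)
  focalTuples = filterᵇ (λ t → all focalColumn (toList t)) (allVecs (allColumns (suc k)) n)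

  code : Vec (Vec (Fin q) (suc k)) n → Vec (Fin N) (suc k)
  code t = Vec.map encode (rows t)

  C : List (Vec (Fin N) (suc k))
  C = filter (λ c → unique? (toList c)) (map code focalTuples)

  length-C : length C ≤ N * K ^ n
  length-C = begin
    length C
      ≤⟨ length-filter (λ c → unique? (toList c)) (map code focalTuples) ⟩
    length (map code focalTuples)
      ≡⟨ trans (length-map code focalTuples) (length-filterᵇ (λ t → all focalColumn (toList t)) (allVecs (allColumns (suc k)) n)) ⟩
    count (λ t → all focalColumn (toList t)) (allVecs (allColumns (suc k)) n)
      ≤⟨ count-focalTuple k n ⟩
    N * K ^ n ∎
    where open ≤-Reasoning

  open Alteration M₀ N k C (λ c∈ → proj₂ (∈.∈-filter⁻ (λ c → unique? (toList c)) {xs = map code focalTuples} c∈))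

  G : List (Fin N)
  G = proj₁ alteration

  family : Family q n
  family = map decode G

  family-unique : Unique family
  family-unique = Unique.map⁺ decode-injective (proj₁ (proj₂ alteration))

  encode∈G : ∀ {w} → w ∈ family → encode w ∈ G
  encode∈G w∈ with ∈.∈-map⁻ decode w∈
  ... | g , g∈G , refl = subst (_∈ G) (sym (encode-decode {q} {n} g)) g∈G

  family-free : ¬ ContainsFocal (suc k) family
  family-free (x₀ , ys , x₀∈ , ys∈ , focal) = proj₁ (proj₂ (proj₂ alteration)) code∈C codes∈G
    where
    tuple = focal⇒focalTuple focal
    t = proj₁ tuple
    toList-code : toList (code t) ≡ map encode (x₀ ∷ ys)
    toList-code = trans (Vec.toList-map encode (rows t)) (cong (map encode) (proj₂ (proj₂ tuple)))
    code∈C : code t ∈ C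
    code∈C = ∈.∈-filter⁺ (λ c → unique? (toList c))
      (∈.∈-map⁺ code (∈.∈-filter⁺ (λ t → T? (all focalColumn (toList t)))
                       (∈-allVecs (∈-allVecs ∈.∈-allFin) t) (proj₁ (proj₂ tuple))))
      (subst Unique (sym toList-code) (Unique.map⁺ encode-injective (proj₁ focal)))
    codes∈G : All (_∈ G) (toList (code t))
    codes∈G = subst (All (_∈ G)) (sym toList-code) (All.map⁺ (All.map encode∈G (x₀∈ All.∷ ys∈)))

  family-large : 2 * K ^ n ≤ M ^ k → N ≤ 2 * M * length family
  family-large 2Kⁿ≤Mᵏ = *-cancelʳ-≤ N (2 * M * length family) (M ^ k) {{m^n≢0 M k}}
    (subst (N * M ^ k ≤_) (trans (regroup M (length G) (M ^ k)) (cong (λ l → 2 * M * l * M ^ k) (sym (length-map (decode {q} {n}) G))))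
      (+-cancelʳ-≤ X X (2 * Y) X+X≤2Y+X))
    where
    X = N * M ^ k
    Y = length G * M ^ suc k
    2C≤X : 2 * length C ≤ X
    2C≤X = begin
      2 * length C      ≤⟨ *-monoʳ-≤ 2 length-C ⟩
      2 * (N * K ^ n)   ≡⟨ x*[y*z]≡y*[x*z] 2 N (K ^ n) ⟩
      N * (2 * K ^ n)   ≤⟨ *-monoʳ-≤ N 2Kⁿ≤Mᵏ ⟩
      X                 ∎
      where
      open ≤-Reasoning
      x*[y*z]≡y*[x*z] : ∀ x y z → x * (y * z) ≡ y * (x * z)
      x*[y*z]≡y*[x*z] = solve-∀
    X+X≤2Y+X : X + X ≤ 2 * Y + X
    X+X≤2Y+X = begin
      X + X                              ≤⟨ +-mono-≤ (proj₂ (proj₂ (proj₂ alteration))) (proj₂ (proj₂ (proj₂ alteration))) ⟩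
      (Y + length C) + (Y + length C)    ≡⟨ double Y (length C) ⟩
      2 * Y + 2 * length C               ≤⟨ +-monoʳ-≤ (2 * Y) 2C≤X ⟩
      2 * Y + X                          ∎
      where
      open ≤-Reasoning
      double : ∀ y c → (y + c) + (y + c) ≡ 2 * y + 2 * c
      double = solve-∀
    regroup : ∀ m g p → 2 * (g * (m * p)) ≡ 2 * m * g * p
    regroup = solve-∀

root-between : ∀ e X → 1 ≤ X → Σ ℕ λ M₀ → X ≤ suc M₀ ^ suc e × suc M₀ ^ suc e ≤ 2 ^ suc e * X
root-between e X 1≤X = descend X (≤-trans (≤-reflexive (sym (*-identityʳ X))) (*-monoʳ-≤ X (m^n>0 X {{>-nonZero 1≤X}} e)))
  where
  descend : ∀ t → X ≤ t ^ suc e → Σ ℕ λ M₀ → X ≤ suc M₀ ^ suc e × suc M₀ ^ suc e ≤ 2 ^ suc e * X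
  descend zero          X≤0 = contradiction (≤-trans 1≤X X≤0) (λ ())
  descend (suc t)       X≤tᵉ with X ≤? t ^ suc e
  ... | yes X≤ = descend t X≤
  descend (suc zero)    X≤1 | no _ = zero , X≤1 , ≤-trans (≤-reflexive (^-zeroˡ (suc e))) (*-mono-≤ (m^n>0 2 (suc e)) 1≤X)
  descend (suc (suc t)) X≤tᵉ | no tᵉ≮X = suc t , X≤tᵉ , (begin
    (2 + t) ^ suc e           ≤⟨ ^-monoˡ-≤ (suc e) (+-monoʳ-≤ 2 (m≤n+m t t)) ⟩
    (2 + (t + t)) ^ suc e     ≡⟨ cong (_^ suc e) (double t) ⟩
    (2 * suc t) ^ suc e       ≡⟨ ^-distribʳ-* 2 (suc t) (suc e) ⟩
    2 ^ suc e * suc t ^ suc e ≤⟨ *-monoʳ-≤ (2 ^ suc e) (<⇒≤ (≰⇒> tᵉ≮X)) ⟩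
    2 ^ suc e * X             ∎)
    where
    open ≤-Reasoning
    double : ∀ t → 2 + (t + t) ≡ 2 * suc t
    double = solve-∀

-- The 8 collects |F| ≥ q^n/(2M) and M^k ≤ 2^k · 2Kⁿ ≤ 4^k Kⁿ.
lowerBound : ∀ q₀ k′ n → Σ (Family (suc q₀) n) λ F → Unique F × ¬ ContainsFocal (suc (suc k′)) F ×
  (suc q₀ ^ n) ^ suc k′ ≤ (8 * length F) ^ suc k′ * (q₀ * suc k′ + 1) ^ n
lowerBound q₀ k′ n = family , family-unique , family-free , (begin
  N ^ k                       ≤⟨ ^-monoˡ-≤ k (family-large X≤Mᵏ) ⟩
  (2 * M * L) ^ k             ≡⟨ trans (^-distribʳ-* (2 * M) L k) (cong (_* L ^ k) (^-distribʳ-* 2 M k)) ⟩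
  2 ^ k * M ^ k * L ^ k       ≤⟨ *-monoˡ-≤ (L ^ k) (*-monoʳ-≤ (2 ^ k) Mᵏ≤2ᵏX) ⟩
  2 ^ k * (2 ^ k * X) * L ^ k ≡⟨ regroup (2 ^ k) (K ^ n) (L ^ k) ⟩
  2 ^ k * 2 ^ k * 2 * (L ^ k * K ^ n) ≤⟨ *-monoˡ-≤ (L ^ k * K ^ n) (*-monoʳ-≤ (2 ^ k * 2 ^ k) (^-monoʳ-≤ 2 {1} {k} (s≤s z≤n))) ⟩
  2 ^ k * 2 ^ k * 2 ^ k * (L ^ k * K ^ n) ≡⟨ cong (_* (L ^ k * K ^ n)) eight ⟩
  8 ^ k * (L ^ k * K ^ n)     ≡⟨ trans (sym (*-assoc (8 ^ k) (L ^ k) (K ^ n))) (cong (_* K ^ n) (sym (^-distribʳ-* 8 L k))) ⟩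
  (8 * L) ^ k * K ^ n         ∎)
  where
  open ≤-Reasoning
  k = suc k′
  X = 2 * (q₀ * k + 1) ^ n
  1≤X : 1 ≤ X
  1≤X = ≤-trans (≤-reflexive (sym (^-zeroˡ n))) (≤-trans (^-monoˡ-≤ n (m≤n+m 1 (q₀ * k))) (m≤m+n _ _))
  root = root-between k′ X 1≤X
  M₀ = proj₁ root
  M = suc M₀
  X≤Mᵏ = proj₁ (proj₂ root)
  Mᵏ≤2ᵏX = proj₂ (proj₂ root)
  open LowerBound q₀ k n M₀
  L = length family
  regroup : ∀ a b l → a * (a * (2 * b)) * l ≡ a * a * 2 * (l * b)
  regroup = solve-∀
  eight : 2 ^ k * 2 ^ k * 2 ^ k ≡ 8 ^ k
  eight = trans (*-assoc (2 ^ k) (2 ^ k) (2 ^ k))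
            (trans (cong (2 ^ k *_) (sym (^-distribʳ-* 2 2 k))) (sym (^-distribʳ-* 2 4 k)))

theorem2 : (q r : ℕ) → 2 ≤ q → 3 ≤ r →
    Σ ℕ λ a → Σ ℕ λ b → 0 < a × 0 < b ×
      ((n : ℕ) → 1 ≤ n →
        (Σ (Family q n) λ F → Unique F × ¬ ContainsFocal r F ×
           (a * q ^ n) ^ (r ∸ 1)
             ≤ (b * length F) ^ (r ∸ 1) * ((q ∸ 1) * (r ∸ 1) + 1) ^ n)
        ×
        ((F : Family q n) → Unique F → ¬ ContainsFocal r F →
           length F ≤ (r ∸ 1) * q ^ ceilDiv ((r ∸ 2) * n) (r ∸ 1)))
theorem2 (suc (suc q′)) (suc (suc (suc r′))) (s≤s (s≤s _)) (s≤s (s≤s (s≤s _))) =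
  1 , 8 , s≤s z≤n , s≤s z≤n , λ n _ → lower n , upperBound q (suc r′) n
  where
  q = suc (suc q′)
  k = suc (suc r′)
  lower : ∀ n → Σ (Family q n) λ F → Unique F × ¬ ContainsFocal (suc k) F ×
                  (1 * q ^ n) ^ k ≤ (8 * length F) ^ k * (suc q′ * k + 1) ^ n
  lower n = case lowerBound (suc q′) (suc r′) n of λ where
    (F , F-unique , F-free , bound) → F , F-unique , F-free , ≤-trans (≤-reflexive (cong (_^ k) (*-identityˡ (q ^ n)))) bound
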